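{- Let $H^R$ be a real robust Hadamard matrix of order $n$. Then there exists a skew Hadamard matrix $H^S$ of order $n$ that is sign-equivalent to $H^R$, i.e. $H^S=D_1H^RD_2$ for some diagonal matrices $D_1,D_2$ with diagonal entries in $\{1,-1\}$.
   Context: A (complex) Hadamard matrix of order $n$ is $H\in M_n(\mathbb{C})$ with $|H_{ij}|=1$ for all $i,j$ and $HH^*=n\mathbb{I}$; it is real if all entries are real. $H$ is robust Hadamard if it is Hadamard and for all $i\neq j$ the principal $2\times2$ submatrix $\begin{pmatrix}H_{ii}&H_{ij}\\ H_{ji}&H_{jj}\end{pmatrix}$ is a Hadamard matrix of order $2$. A skew Hadamard matrix is a real Hadamard matrix $H$ with $H+H^T=2\mathbb{I}$. -}

module Defs where

open import Data.Nat using (ℕ; zero; suc)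
open import Data.Integer using (ℤ; +_; -_; _+_; _*_; ∣_∣; 0ℤ; 1ℤ)
open import Data.Fin using (Fin; zero; suc)
open import Data.Product using (_×_; ∃)
open import Data.Sum using (_⊎_)
open import Relation.Binary.PropositionalEquality using (_≡_; _≢_)

Matrix : ℕ → Set
Matrix n = Fin n → Fin n → ℤ

Σ : (n : ℕ) → (Fin n → ℤ) → ℤ
Σ zero    f = 0ℤ
Σ (suc n) f = f zero + Σ n (λ k → f (suc k))

δ : {n : ℕ} → Fin n → Fin n → ℤ
δ zero    zero    = 1ℤ
δ zero    (suc _) = 0ℤ
δ (suc _) zero    = 0ℤ
δ (suc i) (suc j) = δ i j

transpose : {n : ℕ} → Matrix n → Matrix n
transpose H i j = H j i

-- (H Hᵀ)_{ij}; for a real matrix H* = Hᵀ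
HHᵀ : {n : ℕ} → Matrix n → Matrix n
HHᵀ {n} H i j = Σ n (λ k → H i k * H j k)

IsHadamard : (n : ℕ) → Matrix n → Set
IsHadamard n H =
  (∀ i j → ∣ H i j ∣ ≡ 1) × (∀ i j → HHᵀ H i j ≡ (+ n) * δ i j)

principal2 : {n : ℕ} → Matrix n → Fin n → Fin n → Matrix 2
principal2 H i j zero    zero    = H i i
principal2 H i j zero    (suc _) = H i j
principal2 H i j (suc _) zero    = H j i
principal2 H i j (suc _) (suc _) = H j j

IsRobustHadamard : (n : ℕ) → Matrix n → Set
IsRobustHadamard n H =
  IsHadamard n H × (∀ i j → i ≢ j → IsHadamard 2 (principal2 H i j))

IsSkewHadamard : (n : ℕ) → Matrix n → Set
IsSkewHadamard n H =
  IsHadamard n H × (∀ i j → H i j + H j i ≡ (+ 2) * δ i j)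

-- a diagonal sign matrix, given by its diagonal entries in {1, -1}
IsSignVector : {n : ℕ} → (Fin n → ℤ) → Set
IsSignVector d = ∀ i → (d i ≡ 1ℤ) ⊎ (d i ≡ - 1ℤ)

diagMul : {n : ℕ} → (Fin n → ℤ) → Matrix n → (Fin n → ℤ) → Matrix n
diagMul d₁ H d₂ i j = d₁ i * H i j * d₂ j

SignEquivalent : (n : ℕ) → Matrix n → Matrix n → Set
SignEquivalent n S H =
  ∃ λ (d₁ : Fin n → ℤ) → ∃ λ (d₂ : Fin n → ℤ) →
    IsSignVector d₁ × IsSignVector d₂ × (∀ i j → S i j ≡ diagMul d₁ H d₂ i j)

-- Multiplying every row of H by its diagonal entry H i i keeps H Hadamard and
-- makes the diagonal all ones. Off the diagonal, orthogonality of the rows of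
-- the principal 2×2 submatrix on {i, j} reads H i i H j i + H i j H j j = 0;
-- multiplying by H i j H j i (whose squares are 1) turns this into
-- H i i H i j + H j j H j i = 0, which is skew-symmetry of the rescaled matrix.
module Submission where

open import Defs
open import Data.Nat as ℕ using (ℕ)
open import Data.Product using (_×_; ∃; _,_; proj₂)
open import Data.Sum using (_⊎_; inj₁; inj₂)
open import Data.Fin using (Fin; zero; suc)
open import Data.Fin.Properties using (_≟_)
open import Data.Integer using (ℤ; +_; -_; _+_; _*_; ∣_∣; 0ℤ; 1ℤ; -[1+_])
open import Data.Integer.Properties
  using (*-distribˡ-+; *-zeroʳ; *-identityˡ; *-identityʳ; +-identityʳ; abs-*)
open import Data.Integer.Tactic.RingSolver using (solve-∀)
open import Relation.Binary.PropositionalEquality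
open import Relation.Nullary using (yes; no; contradiction)
open import Function using (_∘_)
open ≡-Reasoning

private
  variable
    n : ℕ

∣x∣≡1⇒unit : ∀ x → ∣ x ∣ ≡ 1 → (x ≡ 1ℤ) ⊎ (x ≡ - 1ℤ)
∣x∣≡1⇒unit (+ 1)      refl = inj₁ refl
∣x∣≡1⇒unit -[1+ 0 ]   refl = inj₂ refl

unit⇒∣x∣≡1 : ∀ {x} → (x ≡ 1ℤ) ⊎ (x ≡ - 1ℤ) → ∣ x ∣ ≡ 1
unit⇒∣x∣≡1 (inj₁ refl) = refl
unit⇒∣x∣≡1 (inj₂ refl) = refl

unit⇒x*x≡1 : ∀ {x} → (x ≡ 1ℤ) ⊎ (x ≡ - 1ℤ) → x * x ≡ 1ℤ
unit⇒x*x≡1 (inj₁ refl) = refl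
unit⇒x*x≡1 (inj₂ refl) = refl

∣x∣≡1⇒x*x≡1 : ∀ x → ∣ x ∣ ≡ 1 → x * x ≡ 1ℤ
∣x∣≡1⇒x*x≡1 x h = unit⇒x*x≡1 (∣x∣≡1⇒unit x h)

Σ-cong : {f g : Fin n → ℤ} → (∀ k → f k ≡ g k) → Σ n f ≡ Σ n g
Σ-cong {ℕ.zero}  f≗g = refl
Σ-cong {ℕ.suc n} f≗g = cong₂ _+_ (f≗g zero) (Σ-cong (f≗g ∘ suc))

*-distribˡ-Σ : ∀ c (f : Fin n → ℤ) → c * Σ n f ≡ Σ n (λ k → c * f k)
*-distribˡ-Σ {ℕ.zero}  c f = *-zeroʳ c
*-distribˡ-Σ {ℕ.suc n} c f = begin
  c * (f zero + Σ n (f ∘ suc))      ≡⟨ *-distribˡ-+ c (f zero) _ ⟩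
  c * f zero + c * Σ n (f ∘ suc)    ≡⟨ cong (λ s → c * f zero + s) (*-distribˡ-Σ c (f ∘ suc)) ⟩
  c * f zero + Σ n (λ k → c * f (suc k)) ∎

δ-refl : (i : Fin n) → δ i i ≡ 1ℤ
δ-refl zero    = refl
δ-refl (suc i) = δ-refl i

δ-≢ : {i j : Fin n} → i ≢ j → δ i j ≡ 0ℤ
δ-≢ {i = zero}  {zero}  i≢j = contradiction refl i≢j
δ-≢ {i = zero}  {suc j} i≢j = refl
δ-≢ {i = suc i} {zero}  i≢j = refl
δ-≢ {i = suc i} {suc j} i≢j = δ-≢ (i≢j ∘ cong suc)

signs*δ≡δ : (d : Fin n → ℤ) → IsSignVector d → ∀ i j → d i * d j * δ i j ≡ δ i j
signs*δ≡δ d ±d i j with i ≟ j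
... | yes refl = trans (cong (_* δ i i) (unit⇒x*x≡1 (±d i))) (*-identityˡ _)
... | no  i≢j  rewrite δ-≢ i≢j = *-zeroʳ (d i * d j)

rowScale : (Fin n → ℤ) → Matrix n → Matrix n
rowScale d H = diagMul d H (λ _ → 1ℤ)

HHᵀ-rowScale : ∀ d (H : Matrix n) i j →
  HHᵀ (rowScale d H) i j ≡ d i * d j * HHᵀ H i j
HHᵀ-rowScale {n} d H i j = begin
  Σ n (λ k → d i * H i k * 1ℤ * (d j * H j k * 1ℤ))
    ≡⟨ Σ-cong (λ k → regroup (d i) (d j) (H i k) (H j k)) ⟩
  Σ n (λ k → d i * d j * (H i k * H j k))
    ≡⟨ sym (*-distribˡ-Σ (d i * d j) (λ k → H i k * H j k)) ⟩
  d i * d j * HHᵀ H i j ∎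
  where
  regroup : ∀ a b x y → a * x * 1ℤ * (b * y * 1ℤ) ≡ a * b * (x * y)
  regroup = solve-∀

rowScale-isHadamard : ∀ d (H : Matrix n) → IsSignVector d →
  IsHadamard n H → IsHadamard n (rowScale d H)
rowScale-isHadamard {n} d H ±d (∣H∣≡1 , orth) = ∣rowScale∣≡1 , orthScaled
  where
  ∣rowScale∣≡1 : ∀ i j → ∣ rowScale d H i j ∣ ≡ 1
  ∣rowScale∣≡1 i j = begin
    ∣ d i * H i j * 1ℤ ∣      ≡⟨ cong ∣_∣ (*-identityʳ (d i * H i j)) ⟩
    ∣ d i * H i j ∣           ≡⟨ abs-* (d i) (H i j) ⟩
    ∣ d i ∣ ℕ.* ∣ H i j ∣     ≡⟨ cong₂ ℕ._*_ (unit⇒∣x∣≡1 (±d i)) (∣H∣≡1 i j) ⟩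
    1                         ∎
  orthScaled : ∀ i j → HHᵀ (rowScale d H) i j ≡ + n * δ i j
  orthScaled i j = begin
    HHᵀ (rowScale d H) i j    ≡⟨ HHᵀ-rowScale d H i j ⟩
    d i * d j * HHᵀ H i j     ≡⟨ cong (d i * d j *_) (orth i j) ⟩
    d i * d j * (+ n * δ i j) ≡⟨ swap (d i * d j) (+ n) (δ i j) ⟩
    + n * (d i * d j * δ i j) ≡⟨ cong (+ n *_) (signs*δ≡δ d ±d i j) ⟩
    + n * δ i j               ∎
    where
    swap : ∀ a b c → a * (b * c) ≡ b * (a * c)
    swap = solve-∀

rowScale-signEquivalent : ∀ d (H : Matrix n) → IsSignVector d →
  SignEquivalent n (rowScale d H) H
rowScale-signEquivalent d H ±d =
  d , (λ _ → 1ℤ) , ±d , (λ _ → inj₁ refl) , (λ _ _ → refl)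

orthogonal⇒antisymmetric : ∀ a b c d → b * b ≡ 1ℤ → c * c ≡ 1ℤ →
  a * c + b * d ≡ 0ℤ → a * b + d * c ≡ 0ℤ
orthogonal⇒antisymmetric a b c d b²≡1 c²≡1 orth = begin
  a * b + d * c
    ≡⟨ cong₂ _+_ (*-identityʳ (a * b)) (*-identityˡ (d * c)) ⟨
  a * b * 1ℤ + 1ℤ * (d * c)
    ≡⟨ cong₂ _+_ (cong (a * b *_) c²≡1) (cong (_* (d * c)) b²≡1) ⟨
  a * b * (c * c) + b * b * (d * c)
    ≡⟨ factor a b c d ⟩
  b * c * (a * c + b * d)
    ≡⟨ cong (b * c *_) orth ⟩
  b * c * 0ℤ
    ≡⟨ *-zeroʳ (b * c) ⟩
  0ℤ ∎
  where
  factor : ∀ a b c d → a * b * (c * c) + b * b * (d * c) ≡ b * c * (a * c + b * d)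
  factor = solve-∀

diagonal : Matrix n → Fin n → ℤ
diagonal H i = H i i

principal2-orthogonal : ∀ {H : Matrix n} → IsRobustHadamard n H → ∀ {i j} → i ≢ j →
  H i i * H j i + H i j * H j j ≡ 0ℤ
principal2-orthogonal {H = H} (_ , robust) {i} {j} i≢j =
  trans (cong (λ s → H i i * H j i + s) (sym (+-identityʳ (H i j * H j j))))
        (proj₂ (robust i j i≢j) zero (suc zero))

rowScale-diagonal-skew : ∀ {H : Matrix n} → IsRobustHadamard n H → ∀ i j →
  rowScale (diagonal H) H i j + rowScale (diagonal H) H j i ≡ + 2 * δ i j
rowScale-diagonal-skew {H = H} robust@((∣H∣≡1 , _) , _) i j with i ≟ j
... | yes refl = begin
  H i i * H i i * 1ℤ + H i i * H i i * 1ℤ ≡⟨ cong₂ _+_ diag² diag² ⟩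
  + 2                                     ≡⟨ cong (λ x → + 2 * x) (δ-refl i) ⟨
  + 2 * δ i i                             ∎
  where
  diag² : H i i * H i i * 1ℤ ≡ 1ℤ
  diag² = cong (_* 1ℤ) (∣x∣≡1⇒x*x≡1 (H i i) (∣H∣≡1 i i))
... | no i≢j = begin
  H i i * H i j * 1ℤ + H j j * H j i * 1ℤ
    ≡⟨ cong₂ _+_ (*-identityʳ (H i i * H i j)) (*-identityʳ (H j j * H j i)) ⟩
  H i i * H i j + H j j * H j i
    ≡⟨ orthogonal⇒antisymmetric (H i i) (H i j) (H j i) (H j j) (square i j) (square j i)
         (principal2-orthogonal robust i≢j) ⟩
  0ℤ
    ≡⟨ cong (λ x → + 2 * x) (δ-≢ i≢j) ⟨
  + 2 * δ i j ∎
  where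
  square : ∀ k l → H k l * H k l ≡ 1ℤ
  square k l = ∣x∣≡1⇒x*x≡1 (H k l) (∣H∣≡1 k l)

mainTheorem3 : (n : ℕ) → (HR : Matrix n) → IsRobustHadamard n HR →
    ∃ λ (HS : Matrix n) → IsSkewHadamard n HS × SignEquivalent n HS HR
mainTheorem3 n H robust@(hadamard@(∣H∣≡1 , _) , _) =
  rowScale (diagonal H) H ,
  (rowScale-isHadamard (diagonal H) H ±diagonal hadamard , rowScale-diagonal-skew robust) ,
  rowScale-signEquivalent (diagonal H) H ±diagonal
  where
  ±diagonal : IsSignVector (diagonal H)
  ±diagonal i = ∣x∣≡1⇒unit (H i i) (∣H∣≡1 i i)
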